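{- Let $q$ be a prime power, $G$ a group, and $\rho\colon G\to\mathrm{GL}_2(\mathbb F_q)$ a homomorphism with image $G_0$. Suppose $[\mathrm{GL}_2(\mathbb F_q):G_0]<(q+1)/2$. Then for no index-$2$ subgroup $H\subset G$ and no character $\chi\colon G\to\mathbb F_q^\times$ is there a nonzero vector of $\mathbb F_q^{\oplus2}$ fixed by $(\rho\otimes\chi)(H)$. -}

module Defs where

open import Level using (Level; _⊔_)
open import Data.Nat using (ℕ; suc; _^_)
open import Data.Nat.Primality using (Prime)
open import Data.Fin using (Fin)
open import Data.Product using (Σ; ∃; _×_; _,_)
open import Data.Sum using (_⊎_)
open import Data.List using (List; length)
open import Data.List.Relation.Unary.Unique.Propositional using (Unique)
open import Data.List.Membership.Propositional using (_∈_)
open import Function.Bundles using (_↔_; _⇔_)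
open import Relation.Nullary using (¬_)
open import Relation.Binary.PropositionalEquality using (_≡_)
open import Algebra.Bundles using (Group)
import Algebra.Structures as AS

IsPrimePower : ℕ → Set
IsPrimePower q = Σ ℕ λ p → Σ ℕ λ k → Prime p × q ≡ p ^ suc k

record FiniteField (q : ℕ) : Set₁ where
  field
    Carrier : Set
    _+_ _*_ : Carrier → Carrier → Carrier
    -_      : Carrier → Carrier
    0# 1#   : Carrier
    isCommutativeRing : AS.IsCommutativeRing (_≡_ {A = Carrier}) _+_ _*_ -_ 0# 1#
    0≢1     : ¬ (0# ≡ 1#)
    inverse : ∀ x → ¬ (x ≡ 0#) → Σ Carrier λ y → x * y ≡ 1#
    size    : Fin q ↔ Carrier

  infixl 7 _*_
  infixl 6 _+_ _-_

  _-_ : Carrier → Carrier → Carrier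
  x - y = x + (- y)

  -- 2×2 matrices  ( a b ; c d )
  record M2 : Set where
    eta-equality
    constructor mat
    field a b c d : Carrier

  record V2 : Set where
    eta-equality
    constructor vec
    field x y : Carrier

  det : M2 → Carrier
  det (mat a b c d) = a * d - b * c

  IsGL2 : M2 → Set
  IsGL2 m = ¬ (det m ≡ 0#)

  _·_ : M2 → M2 → M2
  mat a b c d · mat a' b' c' d' =
    mat (a * a' + b * c') (a * b' + b * d') (c * a' + d * c') (c * b' + d * d')

  act : Carrier → M2 → V2 → V2
  act s (mat a b c d) (vec x y) = vec (s * (a * x + b * y)) (s * (c * x + d * y))

  zeroV : V2
  zeroV = vec 0# 0#

HasCard : ∀ {a p} {A : Set a} → (A → Set p) → ℕ → Set (a ⊔ p)
HasCard {A = A} P n =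
  Σ (List A) λ xs → Unique xs × (∀ z → (P z ⇔ (z ∈ xs))) × length xs ≡ n

module _ {c ℓ : Level} (G : Group c ℓ) {q : ℕ} (F : FiniteField q) where
  open Group G renaming (Carrier to |G|)
  open FiniteField F renaming (Carrier to K; _*_ to _*K_)

  record IsGL2Rep (ρ : |G| → M2) : Set (c ⊔ ℓ) where
    field
      ρ-cong  : ∀ {g h} → g ≈ h → ρ g ≡ ρ h
      ρ-GL2   : ∀ g → IsGL2 (ρ g)
      ρ-hom   : ∀ g h → ρ (g ∙ h) ≡ ρ g · ρ h

  record IsCharacter (χ : |G| → K) : Set (c ⊔ ℓ) where
    field
      χ-cong    : ∀ {g h} → g ≈ h → χ g ≡ χ h
      χ-nonzero : ∀ g → ¬ (χ g ≡ 0#)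
      χ-hom     : ∀ g h → χ (g ∙ h) ≡ χ g *K χ h

  record IsSubgroup {p} (H : |G| → Set p) : Set (c ⊔ ℓ ⊔ p) where
    field
      H-resp : ∀ {g h} → g ≈ h → H g → H h
      H-ε    : H ε
      H-∙    : ∀ {g h} → H g → H h → H (g ∙ h)
      H-⁻¹   : ∀ {g} → H g → H (g ⁻¹)

  -- H is a subgroup of index 2: the left cosets are exactly H and tH for some t ∉ H
  record IsIndex2Subgroup {p} (H : |G| → Set p) : Set (c ⊔ ℓ ⊔ p) where
    field
      subgroup : IsSubgroup H
      t        : |G|
      t∉H      : ¬ H t
      cover    : ∀ g → H g ⊎ H (t ⁻¹ ∙ g)

  Image : (|G| → M2) → M2 → Set c
  Image ρ m = Σ |G| λ g → ρ g ≡ m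

{-# OPTIONS --safe #-}
module Submission where

-- A nonzero vector v fixed by (ρ ⊗ χ)(H) spans a line L that ρ h maps to itself for h ∈ H. As H
-- has index 2, every element of ρ(G) either stabilises L or is moved into the stabiliser B of L by
-- the matrix τ = ρ(t⁻¹). Since GL₂(F_q) permutes the q + 1 lines of F_q² transitively, there are
-- q + 1 matrices A_i with pairwise disjoint cosets A_i B. Hence (i , g) ↦ (coset of g , A_i · g'),
-- with g' the element of B obtained from g, injects Fin (q + 1) × ρ(G) into Fin 2 × GL₂(F_q), so
-- (q + 1) |ρ(G)| ≤ 2 |GL₂(F_q)|, contradicting the index bound.

open import Defs
open import Data.Nat as ℕ using (ℕ; zero; suc)
open import Data.Nat.Properties using (+-suc; <⇒≱)
open import Data.Integer as ℤ using (ℤ; -[1+_]; _⊖_; _◃_; sign; ∣_∣)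
open import Data.Integer.Properties using ([1+m]⊖[1+n]≡m⊖n; ◃-inverse)
open import Data.Sign as Sign using (Sign)
open import Data.Fin as Fin using (Fin)
open import Data.Fin.Properties using (*↔×; injective⇒≤)
open import Data.List using (List; length; lookup)
open import Data.List.Relation.Unary.All as All using ()
open import Data.List.Relation.Unary.AllPairs using (_∷_)
open import Data.List.Relation.Unary.Any as Any using ()
open import Data.List.Relation.Unary.Unique.Propositional using (Unique)
open import Data.List.Membership.Propositional.Properties using (∈-lookup)
open import Data.List.Membership.Setoid.Properties using (index-injective)
open import Data.Maybe using (map)
open import Data.Product using (Σ; _×_; _,_; proj₁; proj₂; map₂; uncurry)
open import Data.Sum using (inj₁; inj₂)
open import Data.Empty using (⊥-elim)
open import Function.Base using (_∘_)
open import Function.Bundles using (Inverse; Injection; Equivalence; mk↣)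
open import Function.Definitions using (Injective)
open import Function.Construct.Composition using (_↣-∘_)
open import Function.Properties.Inverse using (↔⇒↣; ↔-sym)
open import Relation.Nullary using (¬_; Dec; yes; no)
open import Relation.Nullary.Decidable using (via-injection)
open import Relation.Binary.Definitions using (DecidableEquality; WeaklyDecidable)
open import Relation.Binary.Consequences using (dec⇒weaklyDec)
open import Relation.Binary.PropositionalEquality
open import Algebra.Bundles using (CommutativeRing; Group)
open import Algebra.Structures using (IsCommutativeRing)
open import Algebra.Solver.Ring.AlmostCommutativeRing using (fromCommutativeRing; _-Raw-AlmostCommutative⟶_)

-- Algebra.Solver.Ring needs a coefficient ring whose arithmetic computes, so ℤ is interpreted in
-- the ring. Multiples are taken with the TC-optimised _×_, for which 1 × x reduces to x, so that
-- the constant :1# denotes 1# on the nose.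
module CommutativeRingSolver {a} {A : Set a} {add mul : A → A → A} {neg : A → A} {0ᴬ 1ᴬ : A}
  (isCommutativeRing : IsCommutativeRing _≡_ add mul neg 0ᴬ 1ᴬ) where

  commutativeRing : CommutativeRing a a
  commutativeRing = record { isCommutativeRing = isCommutativeRing }

  open CommutativeRing commutativeRing
    using (_+_; _*_; -_; _-_; 0#; 1#; +-assoc; +-comm; +-identityˡ; +-identityʳ; ring; +-abelianGroup; semiring)
  open import Algebra.Properties.Ring ring using (-‿distribˡ-*; -‿distribʳ-*; -‿involutive; -0#≈0#)
  open import Algebra.Properties.AbelianGroup +-abelianGroup using (⁻¹-∙-comm; xyx⁻¹≈y)
  open import Algebra.Properties.Semiring.Mult.TCOptimised semiring
    using (×-homo-+; ×1-homo-*; 1+×) renaming (_×_ to _×ₙ_)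
  open ≡-Reasoning

  ⟦_⟧ℤ : ℤ → A
  ⟦ ℤ.+ n ⟧ℤ = n ×ₙ 1#
  ⟦ -[1+ n ] ⟧ℤ = - (suc n ×ₙ 1#)

  [x+y]-[x+z]≡y-z : ∀ x y z → (x + y) - (x + z) ≡ y - z
  [x+y]-[x+z]≡y-z x y z = begin
    (x + y) + - (x + z)     ≡⟨ cong ((x + y) +_) (sym (⁻¹-∙-comm x z)) ⟩
    (x + y) + (- x + - z)   ≡⟨ sym (+-assoc _ _ _) ⟩
    (x + y) + - x + - z     ≡⟨ cong (_+ - z) (xyx⁻¹≈y x y) ⟩
    y - z                   ∎

  ⟦⊖⟧ : ∀ m n → ⟦ m ⊖ n ⟧ℤ ≡ m ×ₙ 1# - n ×ₙ 1#
  ⟦⊖⟧ m zero = begin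
    m ×ₙ 1#          ≡⟨ sym (+-identityʳ _) ⟩
    m ×ₙ 1# + 0#     ≡⟨ cong (m ×ₙ 1# +_) (sym -0#≈0#) ⟩
    m ×ₙ 1# - 0#     ∎
  ⟦⊖⟧ zero (suc n) = sym (+-identityˡ _)
  ⟦⊖⟧ (suc m) (suc n) = begin
    ⟦ suc m ⊖ suc n ⟧ℤ               ≡⟨ cong ⟦_⟧ℤ ([1+m]⊖[1+n]≡m⊖n m n) ⟩
    ⟦ m ⊖ n ⟧ℤ                       ≡⟨ ⟦⊖⟧ m n ⟩
    m ×ₙ 1# - n ×ₙ 1#                  ≡⟨ sym ([x+y]-[x+z]≡y-z 1# _ _) ⟩
    (1# + m ×ₙ 1#) - (1# + n ×ₙ 1#)    ≡⟨ sym (cong₂ _-_ (1+× m 1#) (1+× n 1#)) ⟩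
    suc m ×ₙ 1# - suc n ×ₙ 1#          ∎

  ⟦+⟧ : ∀ i j → ⟦ i ℤ.+ j ⟧ℤ ≡ ⟦ i ⟧ℤ + ⟦ j ⟧ℤ
  ⟦+⟧ (ℤ.+ m) (ℤ.+ n) = ×-homo-+ 1# m n
  ⟦+⟧ (ℤ.+ m) -[1+ n ] = ⟦⊖⟧ m (suc n)
  ⟦+⟧ -[1+ m ] (ℤ.+ n) = trans (⟦⊖⟧ n (suc m)) (+-comm _ _)
  ⟦+⟧ -[1+ m ] -[1+ n ] = begin
    - (suc (suc (m ℕ.+ n)) ×ₙ 1#)      ≡⟨ cong (λ k → - (suc k ×ₙ 1#)) (sym (+-suc m n)) ⟩
    - ((suc m ℕ.+ suc n) ×ₙ 1#)        ≡⟨ cong -_ (×-homo-+ 1# (suc m) (suc n)) ⟩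
    - (suc m ×ₙ 1# + suc n ×ₙ 1#)       ≡⟨ sym (⁻¹-∙-comm _ _) ⟩
    - (suc m ×ₙ 1#) + - (suc n ×ₙ 1#)   ∎

  signed : Sign → A → A
  signed Sign.+ x = x
  signed Sign.- x = - x

  ⟦◃⟧ : ∀ s n → ⟦ s ◃ n ⟧ℤ ≡ signed s (n ×ₙ 1#)
  ⟦◃⟧ Sign.+ zero = refl
  ⟦◃⟧ Sign.- zero = sym -0#≈0#
  ⟦◃⟧ Sign.+ (suc n) = refl
  ⟦◃⟧ Sign.- (suc n) = refl

  ⟦⟧-sign-abs : ∀ i → ⟦ i ⟧ℤ ≡ signed (sign i) (∣ i ∣ ×ₙ 1#)
  ⟦⟧-sign-abs i = trans (cong ⟦_⟧ℤ (sym (◃-inverse i))) (⟦◃⟧ (sign i) ∣ i ∣)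

  signed-* : ∀ s t x y → signed (s Sign.* t) (x * y) ≡ signed s x * signed t y
  signed-* Sign.+ Sign.+ x y = refl
  signed-* Sign.+ Sign.- x y = -‿distribʳ-* x y
  signed-* Sign.- Sign.+ x y = -‿distribˡ-* x y
  signed-* Sign.- Sign.- x y = begin
    x * y           ≡⟨ sym (-‿involutive _) ⟩
    - - (x * y)     ≡⟨ cong -_ (-‿distribˡ-* x y) ⟩
    - (- x * y)     ≡⟨ -‿distribʳ-* (- x) y ⟩
    - x * - y       ∎

  ⟦*⟧ : ∀ i j → ⟦ i ℤ.* j ⟧ℤ ≡ ⟦ i ⟧ℤ * ⟦ j ⟧ℤ
  ⟦*⟧ i j = begin
    ⟦ s ◃ ∣ i ∣ ℕ.* ∣ j ∣ ⟧ℤ                   ≡⟨ ⟦◃⟧ s (∣ i ∣ ℕ.* ∣ j ∣) ⟩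
    signed s ((∣ i ∣ ℕ.* ∣ j ∣) ×ₙ 1#)         ≡⟨ cong (signed s) (×1-homo-* ∣ i ∣ ∣ j ∣) ⟩
    signed s (∣ i ∣ ×ₙ 1# * ∣ j ∣ ×ₙ 1#)       ≡⟨ signed-* (sign i) (sign j) _ _ ⟩
    signed (sign i) (∣ i ∣ ×ₙ 1#) * signed (sign j) (∣ j ∣ ×ₙ 1#)
                                              ≡⟨ sym (cong₂ _*_ (⟦⟧-sign-abs i) (⟦⟧-sign-abs j)) ⟩
    ⟦ i ⟧ℤ * ⟦ j ⟧ℤ                           ∎
    where s = sign i Sign.* sign j

  ⟦-⟧ : ∀ i → ⟦ ℤ.- i ⟧ℤ ≡ - ⟦ i ⟧ℤ
  ⟦-⟧ (ℤ.+ zero) = sym -0#≈0#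
  ⟦-⟧ (ℤ.+ suc n) = refl
  ⟦-⟧ -[1+ n ] = sym (-‿involutive _)

  integerCoefficients : ℤ.+-*-rawRing -Raw-AlmostCommutative⟶ fromCommutativeRing commutativeRing
  integerCoefficients = record
    { ⟦_⟧ = ⟦_⟧ℤ ; +-homo = ⟦+⟧ ; *-homo = ⟦*⟧ ; -‿homo = ⟦-⟧ ; 0-homo = refl ; 1-homo = refl }

  ⟦⟧-≟ : WeaklyDecidable (λ i j → ⟦ i ⟧ℤ ≡ ⟦ j ⟧ℤ)
  ⟦⟧-≟ i j = map (cong ⟦_⟧ℤ) (dec⇒weaklyDec ℤ._≟_ i j)

  open import Algebra.Solver.Ring ℤ.+-*-rawRing (fromCommutativeRing commutativeRing) integerCoefficients ⟦⟧-≟ public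
    using (Polynomial; solve; con; _:+_; _:*_; :-_; _:-_; _:=_)

  :0# :1# : ∀ {n} → Polynomial n
  :0# = con (ℤ.+ 0)
  :1# = con (ℤ.+ 1)

module FieldArithmetic {q : ℕ} (F : FiniteField q) where
  open FiniteField F renaming (Carrier to K)
  open CommutativeRingSolver isCommutativeRing public
    using (commutativeRing; solve; :0#; :1#; _:+_; _:*_; :-_; _:-_; _:=_)
  open CommutativeRing commutativeRing public using (*-identityˡ; zeroʳ; ring; +-group)
  open import Algebra.Properties.Ring ring public using (-0#≈0#)
  open import Algebra.Properties.Group +-group public using (x∙y⁻¹≈ε⇒x≈y)
  open ≡-Reasoning


  _≟_ : DecidableEquality K
  _≟_ = via-injection (↔⇒↣ (↔-sym size)) Fin._≟_

  *-cancelˡ : ∀ {x y z} → ¬ x ≡ 0# → x * y ≡ x * z → y ≡ z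
  *-cancelˡ {x} {y} {z} x≢0 xy≡xz with inverse x x≢0
  ... | x⁻¹ , xx⁻¹≡1 = trans (undo y) (trans (cong (x⁻¹ *_) xy≡xz) (sym (undo z)))
    where
    undo : ∀ w → w ≡ x⁻¹ * (x * w)
    undo w = begin
      w                ≡⟨ sym (*-identityˡ w) ⟩
      1# * w           ≡⟨ cong (_* w) (sym xx⁻¹≡1) ⟩
      x * x⁻¹ * w      ≡⟨ solve 3 (λ x x⁻¹ w → x :* x⁻¹ :* w := x⁻¹ :* (x :* w)) refl x x⁻¹ w ⟩
      x⁻¹ * (x * w)    ∎

  xy≡0⇒y≡0 : ∀ {x y} → ¬ x ≡ 0# → x * y ≡ 0# → y ≡ 0#
  xy≡0⇒y≡0 {x} x≢0 xy≡0 = *-cancelˡ x≢0 (trans xy≡0 (sym (zeroʳ x)))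

  *-nonzero : ∀ {x y} → ¬ x ≡ 0# → ¬ y ≡ 0# → ¬ x * y ≡ 0#
  *-nonzero x≢0 y≢0 xy≡0 = y≢0 (xy≡0⇒y≡0 x≢0 xy≡0)

module Plane {q : ℕ} (F : FiniteField q) where
  open FiniteField F renaming (Carrier to K)
  open FieldArithmetic F
  open ≡-Reasoning

  infixr 7 _*ᵥ_ _·ᵥ_
  infixl 6 _-ᵥ_

  _*ᵥ_ : K → V2 → V2
  s *ᵥ vec x y = vec (s * x) (s * y)

  _-ᵥ_ : V2 → V2 → V2
  vec x₁ y₁ -ᵥ vec x₂ y₂ = vec (x₁ - x₂) (y₁ - y₂)

  _·ᵥ_ : M2 → V2 → V2
  mat a b c d ·ᵥ vec x y = vec (a * x + b * y) (c * x + d * y)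

  column₁ column₂ : M2 → V2
  column₁ (mat a b c d) = vec a c
  column₂ (mat a b c d) = vec b d

  adj : M2 → M2
  adj (mat a b c d) = mat d (- b) (- c) a

  cross : V2 → V2 → K
  cross (vec x₁ y₁) (vec x₂ y₂) = x₁ * y₂ - y₁ * x₂

  Collinear : V2 → V2 → Set
  Collinear u w = cross u w ≡ 0#

  StabilisesLine : V2 → M2 → Set
  StabilisesLine v m = Collinear v (m ·ᵥ v)

  ·ᵥ-assoc : ∀ A B w → (A · B) ·ᵥ w ≡ A ·ᵥ (B ·ᵥ w)
  ·ᵥ-assoc (mat a b c d) (mat e f g h) (vec x y) = cong₂ vec (row a b) (row c d)
    where
    row : ∀ a b → (a * e + b * g) * x + (a * f + b * h) * y ≡ a * (e * x + f * y) + b * (g * x + h * y)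
    row a b = solve 8 (λ a b e f g h x y →
      (a :* e :+ b :* g) :* x :+ (a :* f :+ b :* h) :* y := a :* (e :* x :+ f :* y) :+ b :* (g :* x :+ h :* y))
      refl a b e f g h x y

  det-· : ∀ A B → det (A · B) ≡ det A * det B
  det-· (mat a b c d) (mat e f g h) = solve 8 (λ a b c d e f g h →
    (a :* e :+ b :* g) :* (c :* f :+ d :* h) :- (a :* f :+ b :* h) :* (c :* e :+ d :* g)
      := (a :* d :- b :* c) :* (e :* h :- f :* g))
    refl a b c d e f g h

  cross-·ᵥ : ∀ A u w → cross (A ·ᵥ u) (A ·ᵥ w) ≡ det A * cross u w
  cross-·ᵥ (mat a b c d) (vec x y) (vec z t) = solve 8 (λ a b c d x y z t →
    (a :* x :+ b :* y) :* (c :* z :+ d :* t) :- (c :* x :+ d :* y) :* (a :* z :+ b :* t)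
      := (a :* d :- b :* c) :* (x :* t :- y :* z))
    refl a b c d x y z t

  adj-·ᵥ : ∀ A w → adj A ·ᵥ (A ·ᵥ w) ≡ det A *ᵥ w
  adj-·ᵥ (mat a b c d) (vec x y) = cong₂ vec
    (solve 6 (λ a b c d x y → d :* (a :* x :+ b :* y) :+ :- b :* (c :* x :+ d :* y) := (a :* d :- b :* c) :* x)
      refl a b c d x y)
    (solve 6 (λ a b c d x y → :- c :* (a :* x :+ b :* y) :+ a :* (c :* x :+ d :* y) := (a :* d :- b :* c) :* y)
      refl a b c d x y)

  ·ᵥ-zeroV : ∀ A → A ·ᵥ zeroV ≡ zeroV
  ·ᵥ-zeroV (mat a b c d) = cong₂ vec (zero-combination a b) (zero-combination c d)
    where
    zero-combination : ∀ a b → a * 0# + b * 0# ≡ 0#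
    zero-combination a b = solve 2 (λ a b → a :* :0# :+ b :* :0# := :0#) refl a b

  *ᵥ-cancelˡ : ∀ {s u w} → ¬ s ≡ 0# → s *ᵥ u ≡ s *ᵥ w → u ≡ w
  *ᵥ-cancelˡ s≢0 su≡sw = cong₂ vec (*-cancelˡ s≢0 (cong V2.x su≡sw)) (*-cancelˡ s≢0 (cong V2.y su≡sw))

  ·ᵥ-injective : ∀ {A u w} → IsGL2 A → A ·ᵥ u ≡ A ·ᵥ w → u ≡ w
  ·ᵥ-injective {A} {u} {w} detA≢0 Au≡Aw = *ᵥ-cancelˡ detA≢0 (begin
    det A *ᵥ u               ≡⟨ sym (adj-·ᵥ A u) ⟩
    adj A ·ᵥ (A ·ᵥ u)        ≡⟨ cong (adj A ·ᵥ_) Au≡Aw ⟩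
    adj A ·ᵥ (A ·ᵥ w)        ≡⟨ adj-·ᵥ A w ⟩
    det A *ᵥ w               ∎)

  ·ᵥ-nonzero : ∀ {A w} → IsGL2 A → ¬ w ≡ zeroV → ¬ A ·ᵥ w ≡ zeroV
  ·ᵥ-nonzero {A} detA≢0 w≢0 Aw≡0 = w≢0 (·ᵥ-injective detA≢0 (trans Aw≡0 (sym (·ᵥ-zeroV A))))

  ·-cancelˡ : ∀ {A M M′} → IsGL2 A → A · M ≡ A · M′ → M ≡ M′
  ·-cancelˡ detA≢0 AM≡AM′ = cong₂ fromColumns
    (·ᵥ-injective detA≢0 (cong column₁ AM≡AM′)) (·ᵥ-injective detA≢0 (cong column₂ AM≡AM′))
    where
    fromColumns : V2 → V2 → M2
    fromColumns (vec a c) (vec b d) = mat a b c d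

  GL2-· : ∀ {A B} → IsGL2 A → IsGL2 B → IsGL2 (A · B)
  GL2-· {A} {B} detA≢0 detB≢0 detAB≡0 = *-nonzero detA≢0 detB≢0 (trans (sym (det-· A B)) detAB≡0)

  collinear-*ᵥ : ∀ s u → Collinear (s *ᵥ u) u
  collinear-*ᵥ s (vec x y) = solve 3 (λ s x y → s :* x :* y :- s :* y :* x := :0#) refl s x y

  fixed⇒stabilisesLine : ∀ {s m v} → act s m v ≡ v → StabilisesLine v m
  fixed⇒stabilisesLine {s} {m} {v} fixed = subst (λ u → Collinear u (m ·ᵥ v)) fixed (collinear-*ᵥ s (m ·ᵥ v))

  collinear-sym : ∀ {u w} → Collinear u w → Collinear w u
  collinear-sym {vec x₁ y₁} {vec x₂ y₂} uw = begin
    x₂ * y₁ - y₂ * x₁     ≡⟨ solve 4 (λ x₁ y₁ x₂ y₂ → x₂ :* y₁ :- y₂ :* x₁ := :- (x₁ :* y₂ :- y₁ :* x₂))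
                               refl x₁ y₁ x₂ y₂ ⟩
    - (x₁ * y₂ - y₁ * x₂) ≡⟨ cong -_ uw ⟩
    - 0#                  ≡⟨ -0#≈0# ⟩
    0#                    ∎

  collinear-·ᵥ : ∀ A {u w} → Collinear u w → Collinear (A ·ᵥ u) (A ·ᵥ w)
  collinear-·ᵥ A {u} {w} uw = trans (cross-·ᵥ A u w) (trans (cong (det A *_) uw) (zeroʳ _))

  cramer : ∀ u u′ w → cross u u′ *ᵥ w ≡ cross u w *ᵥ u′ -ᵥ cross u′ w *ᵥ u
  cramer (vec a₁ a₂) (vec b₁ b₂) (vec w₁ w₂) = cong₂ vec
    (solve 6 (λ a₁ a₂ b₁ b₂ w₁ w₂ →
      (a₁ :* b₂ :- a₂ :* b₁) :* w₁ := (a₁ :* w₂ :- a₂ :* w₁) :* b₁ :- (b₁ :* w₂ :- b₂ :* w₁) :* a₁)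
      refl a₁ a₂ b₁ b₂ w₁ w₂)
    (solve 6 (λ a₁ a₂ b₁ b₂ w₁ w₂ →
      (a₁ :* b₂ :- a₂ :* b₁) :* w₂ := (a₁ :* w₂ :- a₂ :* w₁) :* b₂ :- (b₁ :* w₂ :- b₂ :* w₁) :* a₂)
      refl a₁ a₂ b₁ b₂ w₁ w₂)

  0*ᵥ-0*ᵥ : ∀ u w → 0# *ᵥ u -ᵥ 0# *ᵥ w ≡ zeroV
  0*ᵥ-0*ᵥ (vec x₁ y₁) (vec x₂ y₂) = cong₂ vec (vanishes x₁ x₂) (vanishes y₁ y₂)
    where
    vanishes : ∀ a b → 0# * a - 0# * b ≡ 0#
    vanishes a b = solve 2 (λ a b → :0# :* a :- :0# :* b := :0#) refl a b

  s*ᵥw≡0⇒s≡0 : ∀ {s w} → ¬ w ≡ zeroV → s *ᵥ w ≡ zeroV → s ≡ 0#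
  s*ᵥw≡0⇒s≡0 {s} {vec x y} w≢0 sw≡0 with s ≟ 0#
  ... | yes s≡0 = s≡0
  ... | no s≢0 = ⊥-elim (w≢0 (cong₂ vec (xy≡0⇒y≡0 s≢0 (cong V2.x sw≡0)) (xy≡0⇒y≡0 s≢0 (cong V2.y sw≡0))))

  collinear-trans : ∀ {u u′ w} → ¬ w ≡ zeroV → Collinear u w → Collinear u′ w → Collinear u u′
  collinear-trans {u} {u′} {w} w≢0 uw u′w = s*ᵥw≡0⇒s≡0 w≢0 (begin
    cross u u′ *ᵥ w                          ≡⟨ cramer u u′ w ⟩
    cross u w *ᵥ u′ -ᵥ cross u′ w *ᵥ u       ≡⟨ cong₂ (λ c c′ → c *ᵥ u′ -ᵥ c′ *ᵥ u) uw u′w ⟩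
    0# *ᵥ u′ -ᵥ 0# *ᵥ u                      ≡⟨ 0*ᵥ-0*ᵥ u′ u ⟩
    zeroV                                    ∎)

module Lines {q : ℕ} (F : FiniteField q) where
  open FiniteField F renaming (Carrier to K)
  open FieldArithmetic F
  open Plane F

  record LineTransversal (v : V2) : Set where
    field
      matrix     : Fin (suc q) → M2
      matrix-GL2 : ∀ i → IsGL2 (matrix i)
      separates  : ∀ i j → Collinear (matrix i ·ᵥ v) (matrix j ·ᵥ v) → i ≡ j

  transversal-transport : ∀ {v w P} → IsGL2 P → P ·ᵥ v ≡ w → LineTransversal w → LineTransversal v
  transversal-transport {v} {w} {P} detP≢0 Pv≡w T = record
    { matrix = λ i → matrix i · P
    ; matrix-GL2 = λ i → GL2-· (matrix-GL2 i) detP≢0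
    ; separates = λ i j → separates i j ∘ subst₂ Collinear (image i) (image j)
    }
    where
    open LineTransversal T
    image : ∀ i → (matrix i · P) ·ᵥ v ≡ matrix i ·ᵥ w
    image i = trans (·ᵥ-assoc (matrix i) P v) (cong (matrix i ·ᵥ_) Pv≡w)

  lineTransversal-x≢0 : ∀ {x y} → ¬ x ≡ 0# → LineTransversal (vec x y)
  lineTransversal-x≢0 {x} {y} x≢0 = record { matrix = A ; matrix-GL2 = A-GL2 ; separates = A-separates }
    where
    slope : Fin q → K
    slope = Inverse.to size

    -- A zero sends v to (0 , x) and A (suc k) sends it to (x , k x + y): q + 1 pairwise
    -- non-collinear vectors.
    A : Fin (suc q) → M2
    A Fin.zero = mat y (- x) 1# 0#
    A (Fin.suc k) = mat 1# 0# (slope k) 1#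

    A-GL2 : ∀ i → IsGL2 (A i)
    A-GL2 Fin.zero det≡0 = x≢0 (trans (solve 2 (λ x y → x := y :* :0# :- :- x :* :1#) refl x y) det≡0)
    A-GL2 (Fin.suc k) det≡0 = 0≢1 (sym (trans (solve 1 (λ k → :1# := :1# :* :1# :- :0# :* k) refl (slope k)) det≡0))

    sloped≁vertical : ∀ k → ¬ Collinear (A (Fin.suc k) ·ᵥ vec x y) (A Fin.zero ·ᵥ vec x y)
    sloped≁vertical k c = *-nonzero x≢0 x≢0 (trans (solve 3 (λ x y k →
      x :* x := (:1# :* x :+ :0# :* y) :* (:1# :* x :+ :0# :* y)
                :- (k :* x :+ :1# :* y) :* (y :* x :+ :- x :* y))
      refl x y (slope k)) c)

    cross-slopes : ∀ k l →
      cross (A (Fin.suc k) ·ᵥ vec x y) (A (Fin.suc l) ·ᵥ vec x y) ≡ x * (x * (slope l - slope k))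
    cross-slopes k l = solve 4 (λ x y k l →
      (:1# :* x :+ :0# :* y) :* (l :* x :+ :1# :* y) :- (k :* x :+ :1# :* y) :* (:1# :* x :+ :0# :* y)
        := x :* (x :* (l :- k)))
      refl x y (slope k) (slope l)

    A-separates : ∀ i j → Collinear (A i ·ᵥ vec x y) (A j ·ᵥ vec x y) → i ≡ j
    A-separates Fin.zero Fin.zero _ = refl
    A-separates Fin.zero (Fin.suc l) c = ⊥-elim (sloped≁vertical l (collinear-sym c))
    A-separates (Fin.suc k) Fin.zero c = ⊥-elim (sloped≁vertical k c)
    A-separates (Fin.suc k) (Fin.suc l) c = cong Fin.suc (sym (Injection.injective (↔⇒↣ size)
      (x∙y⁻¹≈ε⇒x≈y _ _ (xy≡0⇒y≡0 x≢0 (xy≡0⇒y≡0 x≢0 (trans (sym (cross-slopes k l)) c))))))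

  rotation : M2
  rotation = mat 0# 1# (- 1#) 0#

  rotation-GL2 : IsGL2 rotation
  rotation-GL2 det≡0 = 0≢1 (sym (trans (solve 0 (:1# := :0# :* :0# :- :1# :* :- :1#) refl) det≡0))

  lineTransversal : ∀ {v} → ¬ v ≡ zeroV → LineTransversal v
  lineTransversal {vec x y} v≢0 with x ≟ 0# | y ≟ 0#
  ... | no x≢0 | _ = lineTransversal-x≢0 x≢0
  ... | yes _ | no y≢0 = transversal-transport rotation-GL2 refl (lineTransversal-x≢0 (y≢0 ∘ trans y≡rotated-x))
    where
    y≡rotated-x : y ≡ 0# * x + 1# * y
    y≡rotated-x = solve 2 (λ x y → y := :0# :* x :+ :1# :* y) refl x y
  ... | yes x≡0 | yes y≡0 = ⊥-elim (v≢0 (cong₂ vec x≡0 y≡0))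

  cosets-disjoint : ∀ {v} → ¬ v ≡ zeroV → (T : LineTransversal v) → ∀ {i j m m′}
    → IsGL2 m → StabilisesLine v m → StabilisesLine v m′
    → LineTransversal.matrix T i · m ≡ LineTransversal.matrix T j · m′ → i ≡ j
  cosets-disjoint {v} v≢0 T {i} {j} {m} {m′} detm≢0 m-stable m′-stable Aᵢm≡Aⱼm′ =
    separates i j (collinear-trans w≢0 (moved i m-stable)
      (subst (Collinear (matrix j ·ᵥ v)) (cong (_·ᵥ v) (sym Aᵢm≡Aⱼm′)) (moved j m′-stable)))
    where
    open LineTransversal T
    w≢0 : ¬ (matrix i · m) ·ᵥ v ≡ zeroV
    w≢0 = ·ᵥ-nonzero (GL2-· (matrix-GL2 i) detm≢0) v≢0
    moved : ∀ k {n} → StabilisesLine v n → Collinear (matrix k ·ᵥ v) ((matrix k · n) ·ᵥ v)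
    moved k {n} n-stable =
      subst (Collinear (matrix k ·ᵥ v)) (sym (·ᵥ-assoc (matrix k) n v)) (collinear-·ᵥ (matrix k) n-stable)

module StabilisedLine {c ℓ p q} (F : FiniteField q) (G : Group c ℓ) {ρ : Group.Carrier G → FiniteField.M2 F}
  (isρ : IsGL2Rep G F ρ) {H : Group.Carrier G → Set p} (index2 : IsIndex2Subgroup G F H)
  {v : FiniteField.V2 F} (v≢0 : ¬ v ≡ FiniteField.zeroV F)
  (ρH-stabilises : ∀ {h} → H h → Plane.StabilisesLine F v (ρ h)) where

  open Group G using (_⁻¹)
  open IsGL2Rep isρ
  open IsIndex2Subgroup index2
  open FiniteField F using (M2; IsGL2; _·_; 0#)
  open FieldArithmetic F using (_≟_)
  open Plane F
  open Lines F
  open LineTransversal (lineTransversal v≢0)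

  τ : M2
  τ = ρ (t ⁻¹)

  stabilises? : ∀ m → Dec (StabilisesLine v m)
  stabilises? m = cross v (m ·ᵥ v) ≟ 0#

  fold : M2 → Fin 2 × M2
  fold m with stabilises? m
  ... | yes _ = Fin.zero , m
  ... | no _ = Fin.suc Fin.zero , τ · m

  fold-stabilises : ∀ g → StabilisesLine v (proj₂ (fold (ρ g)))
  fold-stabilises g with stabilises? (ρ g) | cover g
  ... | yes ρg-stable | _ = ρg-stable
  ... | no ρg-unstable | inj₁ Hg = ⊥-elim (ρg-unstable (ρH-stabilises Hg))
  ... | no _ | inj₂ Ht⁻¹g = subst (StabilisesLine v) (ρ-hom (t ⁻¹) g) (ρH-stabilises Ht⁻¹g)

  fold-GL2 : ∀ g → IsGL2 (proj₂ (fold (ρ g)))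
  fold-GL2 g with stabilises? (ρ g)
  ... | yes _ = ρ-GL2 g
  ... | no _ = GL2-· (ρ-GL2 (t ⁻¹)) (ρ-GL2 g)

  fold-injective : ∀ {m m′} → fold m ≡ fold m′ → m ≡ m′
  fold-injective {m} {m′} eq with stabilises? m | stabilises? m′
  fold-injective refl | yes _ | yes _ = refl
  fold-injective eq | no _ | no _ = ·-cancelˡ (ρ-GL2 (t ⁻¹)) (cong proj₂ eq)
  fold-injective () | yes _ | no _
  fold-injective () | no _ | yes _

  embed : Fin (suc q) → M2 → Fin 2 × M2
  embed i m = proj₁ (fold m) , matrix i · proj₂ (fold m)

  embed-GL2 : ∀ i {m} → Image G F ρ m → IsGL2 (proj₂ (embed i m))
  embed-GL2 i (g , refl) = GL2-· (matrix-GL2 i) (fold-GL2 g)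

  embed-injective : ∀ {i j m m′} → Image G F ρ m → Image G F ρ m′ → embed i m ≡ embed j m′ → i ≡ j × m ≡ m′
  embed-injective {i} {j} (g , refl) (g′ , refl) eq = i≡j , fold-injective (cong₂ _,_ (cong proj₁ eq) fold₂-eq)
    where
    i≡j : i ≡ j
    i≡j = cosets-disjoint v≢0 (lineTransversal v≢0) (fold-GL2 g) (fold-stabilises g) (fold-stabilises g′)
      (cong proj₂ eq)
    fold₂-eq : proj₂ (fold (ρ g)) ≡ proj₂ (fold (ρ g′))
    fold₂-eq = ·-cancelˡ (matrix-GL2 i)
      (trans (cong proj₂ eq) (cong (λ k → matrix k · proj₂ (fold (ρ g′))) (sym i≡j)))

open import Data.Nat using (_*_; _≤_; _<_)

lookup-injective : ∀ {a} {A : Set a} {xs : List A} → Unique xs → ∀ {i j} → lookup xs i ≡ lookup xs j → i ≡ j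
lookup-injective (_ ∷ _) {Fin.zero} {Fin.zero} _ = refl
lookup-injective (x∉xs ∷ _) {Fin.zero} {Fin.suc j} x≡xsⱼ = ⊥-elim (All.lookup x∉xs (∈-lookup j) x≡xsⱼ)
lookup-injective (x∉xs ∷ _) {Fin.suc i} {Fin.zero} xsᵢ≡x = ⊥-elim (All.lookup x∉xs (∈-lookup i) (sym xsᵢ≡x))
lookup-injective (_ ∷ xs-unique) {Fin.suc i} {Fin.suc j} eq = cong Fin.suc (lookup-injective xs-unique eq)

×-card-≤ : ∀ {a b p r} {A : Set a} {B : Set b} {P : A → Set p} {Q : B → Set r} {k l m n}
  → HasCard P m → HasCard Q n
  → (f : Fin k → A → Fin l × B)
  → (∀ i {x} → P x → Q (proj₂ (f i x)))
  → (∀ {i j x y} → P x → P y → f i x ≡ f j y → i ≡ j × x ≡ y)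
  → k * m ≤ l * n
×-card-≤ {P = P} {Q} {k} {l} (xs , xs-unique , xs-complete , refl) (ys , _ , ys-complete , refl) f f-Q f-injective =
  injective⇒≤ (Injection.injective (↔⇒↣ (↔-sym *↔×) ↣-∘ (mk↣ g-injective ↣-∘ ↔⇒↣ *↔×)))
  where
  P-lookup : ∀ j → P (lookup xs j)
  P-lookup j = Equivalence.from (xs-complete _) (∈-lookup j)

  index : ∀ {y} → Q y → Fin (length ys)
  index {y} Qy = Any.index (Equivalence.to (ys-complete y) Qy)

  g : Fin k × Fin (length xs) → Fin l × Fin (length ys)
  g (i , j) = proj₁ (f i (lookup xs j)) , index (f-Q i (P-lookup j))

  g-injective : Injective _≡_ _≡_ g
  g-injective {i , j} {i′ , j′} gᵢⱼ≡gᵢ′ⱼ′ =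
    uncurry (cong₂ _,_) (map₂ (lookup-injective xs-unique) (f-injective (P-lookup j) (P-lookup j′) f-eq))
    where
    f-eq : f i (lookup xs j) ≡ f i′ (lookup xs j′)
    f-eq = cong₂ _,_ (cong proj₁ gᵢⱼ≡gᵢ′ⱼ′) (index-injective (setoid _) _ _ (cong proj₂ gᵢⱼ≡gᵢ′ⱼ′))

proposition4p1 : ∀ {c ℓ p} (q : ℕ) → IsPrimePower q → (F : FiniteField q)
    → (G : Group c ℓ) → (ρ : Group.Carrier G → FiniteField.M2 F) → IsGL2Rep G F ρ
    → (nGL n0 : ℕ) → HasCard (FiniteField.IsGL2 F) nGL → HasCard (Image G F ρ) n0
    → 2 * nGL < suc q * n0
    → (H : Group.Carrier G → Set p) → IsIndex2Subgroup G F H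
    → (χ : Group.Carrier G → FiniteField.Carrier F) → IsCharacter G F χ
    → ¬ (Σ (FiniteField.V2 F) λ v → ¬ (v ≡ FiniteField.zeroV F)
           × (∀ h → H h → FiniteField.act F (χ h) (ρ h) v ≡ v))
proposition4p1 _ _ F G ρ isρ _ _ GL2-card image-card index-small H index2 _ _ (v , v≢0 , fixed) =
  <⇒≱ index-small (×-card-≤ image-card GL2-card embed embed-GL2 embed-injective)
  where
  ρH-stabilises : ∀ {h} → H h → Plane.StabilisesLine F v (ρ h)
  ρH-stabilises {h} Hh = Plane.fixed⇒stabilisesLine F (fixed h Hh)

  open StabilisedLine F G isρ index2 v≢0 ρH-stabilises
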